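{- Let $n\ge 1$, $\Omega_n=\{1,\dots,n\}$, and let $\mathcal{U}$ be a family of subsets of $\Omega_n$ that is closed under pairwise union ($A,B\in\mathcal{U}\Rightarrow A\cup B\in\mathcal{U}$) and contains both $\Omega_n$ and $\emptyset$. Suppose $\mathcal{U}\neq\{\Omega_n\}$, and let $A$ be the largest non-empty element of $\mathcal{U}$ with respect to the total order $>$ described in the context. Then $\mathcal{U}\setminus\{A\}$ is also closed under union.
   Context: For $A\subseteq\Omega_n$ let $b(A)=\sum_{i\in A}2^{i-1}$ (the binary number whose bit $i-1$ is $1$ iff $i\in A$). Subsets of $\Omega_n$ are totally ordered by: $A>B$ if $|A|<|B|$, or $|A|=|B|$ and $b(A)>b(B)$. Thus sets with more elements are "smaller"; "largest" and "smallest" refer to this order. -}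

module Defs where

open import Data.Nat using (ℕ; zero; suc; _+_; _*_; _<_)
open import Data.Bool using (Bool; true; false)
open import Data.Vec using (Vec; []; _∷_)
open import Data.Fin.Subset using (Subset; ∣_∣; Nonempty; _∪_)
open import Data.Product using (_×_)
open import Data.Sum using (_⊎_)
open import Relation.Binary.PropositionalEquality using (_≡_; _≢_)

-- Subset n = Vec Bool n; position (i : Fin n) represents element (toℕ i + 1) of Ω_n.
-- b A = Σ_{i ∈ A} 2^(i-1): the entry at position k contributes 2^k.
b : ∀ {n} → Subset n → ℕ
b []          = 0
b (true ∷ xs)  = 1 + 2 * b xs
b (false ∷ xs) = 2 * b xs

_≻_ : ∀ {n} → Subset n → Subset n → Set
A ≻ B = (∣ A ∣ < ∣ B ∣) ⊎ ((∣ A ∣ ≡ ∣ B ∣) × (b B < b A))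

Family : ℕ → Set₁
Family n = Subset n → Set

ClosedUnderUnion : ∀ {n} → Family n → Set
ClosedUnderUnion {n} U = ∀ (A B : Subset n) → U A → U B → U (A ∪ B)

IsLargestNonempty : ∀ {n} → Family n → Subset n → Set
IsLargestNonempty {n} U A =
  U A × Nonempty A × (∀ (B : Subset n) → U B → Nonempty B → B ≢ A → A ≻ B)

Remove : ∀ {n} → Family n → Subset n → Family n
Remove U A B = U B × B ≢ A

-- If B ⊆ A then A ≻ B is impossible: B ⊆ A gives ∣ B ∣ ≤ ∣ A ∣, with equality only
-- when B = A. Hence no nonempty member of U other than A lies inside A. Were
-- A = B ∪ C with B, C ∈ U ∖ {A}, then B ⊆ A forces B = ∅ and so C = A.
-- The hypotheses n ≥ 1, ⊤ ∈ U, ⊥ ∈ U and U ≠ {⊤} only ensure that A exists.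
module Submission where

open import Defs
open import Data.Nat using (ℕ; _≤_; s≤s)
open import Data.Nat.Properties using (<-irrefl; <⇒≱; ≤-reflexive)
open import Data.Vec using ([]; _∷_; here)
open import Data.Fin.Subset using (Subset; ⊤; ⊥; _∪_; _⊆_; ∣_∣; Empty; inside; outside)
open import Data.Fin.Subset.Properties
  using (p⊆q⇒∣p∣≤∣q∣; p⊆p∪q; drop-∷-⊆; ∪-identityˡ; nonempty?; Empty-unique)
open import Data.Product using (_×_; _,_)
open import Data.Sum using (inj₁; inj₂)
open import Relation.Nullary using (¬_; yes; no; contradiction)
open import Relation.Binary.PropositionalEquality
  using (_≡_; _≢_; refl; cong; subst; module ≡-Reasoning)

p⊆q∧∣q∣≤∣p∣⇒p≡q : ∀ {n} {p q : Subset n} → p ⊆ q → ∣ q ∣ ≤ ∣ p ∣ → p ≡ q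
p⊆q∧∣q∣≤∣p∣⇒p≡q {p = []}          {[]}          _   _       = refl
p⊆q∧∣q∣≤∣p∣⇒p≡q {p = inside ∷ p}  {inside ∷ q}  p⊆q (s≤s h) =
  cong (inside ∷_) (p⊆q∧∣q∣≤∣p∣⇒p≡q (drop-∷-⊆ p⊆q) h)
p⊆q∧∣q∣≤∣p∣⇒p≡q {p = outside ∷ p} {outside ∷ q} p⊆q h       =
  cong (outside ∷_) (p⊆q∧∣q∣≤∣p∣⇒p≡q (drop-∷-⊆ p⊆q) h)
p⊆q∧∣q∣≤∣p∣⇒p≡q {p = inside ∷ p}  {outside ∷ q} p⊆q _       = contradiction (p⊆q here) λ ()
p⊆q∧∣q∣≤∣p∣⇒p≡q {p = outside ∷ p} {inside ∷ q}  p⊆q h       =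
  contradiction (p⊆q⇒∣p∣≤∣q∣ (drop-∷-⊆ p⊆q)) (<⇒≱ h)

p⊆q⇒q⊁p : ∀ {n} {p q : Subset n} → p ⊆ q → ¬ (q ≻ p)
p⊆q⇒q⊁p p⊆q (inj₁ ∣q∣<∣p∣)         = <⇒≱ ∣q∣<∣p∣ (p⊆q⇒∣p∣≤∣q∣ p⊆q)
p⊆q⇒q⊁p p⊆q (inj₂ (∣q∣≡∣p∣ , b<b)) =
  <-irrefl (cong b (p⊆q∧∣q∣≤∣p∣⇒p≡q p⊆q (≤-reflexive ∣q∣≡∣p∣))) b<b

Empty⇒p∪q≡q : ∀ {n} {p : Subset n} (q : Subset n) → Empty p → p ∪ q ≡ q
Empty⇒p∪q≡q q empty = begin
  _ ∪ q ≡⟨ cong (_∪ q) (Empty-unique empty) ⟩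
  ⊥ ∪ q ≡⟨ ∪-identityˡ q ⟩
  q     ∎
  where open ≡-Reasoning

lemma1 : (n : ℕ) → 1 ≤ n → (U : Family n) →
    ClosedUnderUnion U → U ⊤ → U ⊥ →
    ¬ (∀ (B : Subset n) → (U B → B ≡ ⊤) × (B ≡ ⊤ → U B)) →
    (A : Subset n) → IsLargestNonempty U A →
    ClosedUnderUnion (Remove U A)
lemma1 n _ U closed _ _ _ A (_ , _ , largest) B C (B∈U , B≢A) (C∈U , C≢A) =
  closed B C B∈U C∈U , B∪C≢A
  where
  B∪C≢A : B ∪ C ≢ A
  B∪C≢A B∪C≡A with nonempty? B
  ... | yes B≠∅ = p⊆q⇒q⊁p (subst (B ⊆_) B∪C≡A (p⊆p∪q C)) (largest B B∈U B≠∅ B≢A)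
  ... | no  B≡∅ = C≢A (subst (_≡ A) (Empty⇒p∪q≡q C B≡∅) B∪C≡A)
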